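{- Let $n\ge0$ and $S_1\subseteq\mathcal{D}_1$, $S_2\subseteq\mathcal{D}_2$ on the maximal Dyck path $\mathcal{D}^{(n+1)\times n}$. Then $(S_1,S_2)$ is a compatible pair if and only if for every $u_i\in S_1$ and $v_j\in S_2$, $$\max_{C\in(A_iA_{j+1})^\circ}\max\{f(C,A_iA_{j+1}),\,g(C,A_iA_{j+1})\}\ge0.$$
   Context: $\mathcal{D}=\mathcal{D}^{(n+1)\times n}$ is the lattice path from $(0,0)$ to $(n+1,n)$ with vertices $A_0=(0,0)$, $A_1=B_0=(1,0)$, and for $1\le i\le n$, $B_i=(i+1,i-1)$, $A_{i+1}=(i+1,i)$ (the highest unit up/right path not going strictly above the segment from $(0,0)$ to $(n+1,n)$). Horizontal edges $u_i=A_iB_i$ ($0\le i\le n$), $\mathcal{D}_1=\{u_0,\dots,u_n\}$; vertical edges $v_j=B_jA_{j+1}$ ($1\le j\le n$), $\mathcal{D}_2=\{v_1,\dots,v_n\}$. Identify $(n+1,n)$ with $(0,0)$, so $A_{n+1}=A_0$. For lattice points $P,Q$ the subpath $PQ$ goes from $P$ northeast along $\mathcal{D}$ to $Q$, looping from $(n+1,n)$ to $(0,0)$ if needed (if $P=Q$, the full loop); $(PQ)_1,(PQ)_2$ are its horizontal/vertical edges, $(PQ)^\circ$ its lattice points other than $P,Q$. A pair $(S_1,S_2)$ is compatible if for all $u\in S_1$, $v\in S_2$, with $E$ the left endpoint of $u$ and $F$ the upper endpoint of $v$, there is $A\in(EF)^\circ$ with $|(AF)_1|=2|(AF)_2\cap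 S_2|$ or $|(EA)_2|=2|(EA)_1\cap S_1|$. For a subpath $AB$ and $C\in(AB)^\circ$: $f(C,AB)=|(AC)_2|-2|(AC)_1\cap S_1|$ and $g(C,AB)=|(CB)_1|-2|(CB)_2\cap S_2|$. -}

module Defs where

open import Data.Nat using (ℕ; zero; suc; _+_; _*_; _∸_; _≡ᵇ_)
open import Data.Nat.DivMod using (_%_)
open import Data.Bool using (Bool; true; false; if_then_else_)
open import Data.Vec using (Vec; []; _∷_)
open import Data.List using (List; []; _∷_; map; upTo; drop)
open import Data.List.Membership.Propositional using (_∈_)
open import Data.Fin using (Fin; toℕ)
open import Data.Fin.Subset using (Subset) renaming (_∈_ to _∈ₛ_)
open import Data.Integer using (ℤ; +_; _-_; _⊔_; _≥_; -[1+_])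
open import Data.Product using (∃-syntax; _×_)
open import Data.Sum using (_⊎_)

-- The maximal Dyck path D^{(n+1)×n}, traversed cyclically.
--
-- Its lattice points, in path order, are
--   A₀, A₁(=B₀), B₁, A₂, B₂, …, Aₙ, Bₙ   (then A_{n+1} = A₀),
-- i.e. N = 2n+1 distinct points.  We index them by positions 0 … N-1:
--   A₀ ↦ 0,   A_i ↦ 2i-1 (i ≥ 1),   B_i ↦ 2i (i ≥ 1).
-- The edge with index e goes from the point at position e to the point
-- at position e+1 (mod N).  Hence
--   edge 0 = u₀,  edge 2k-1 = u_k (k ≥ 1),  edge 2k = v_k (k ≥ 1).

Npts : ℕ → ℕ
Npts n = suc (n + n)

data Edge : Set where
  hor : ℕ → Edge
  ver : ℕ → Edge

shiftE : Edge → Edge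
shiftE (hor i) = hor (suc i)
shiftE (ver j) = ver (suc j)

edgeSuc : ℕ → Edge
edgeSuc zero = hor 1
edgeSuc (suc zero) = ver 1
edgeSuc (suc (suc e)) = shiftE (edgeSuc e)

edgeAt : ℕ → Edge
edgeAt zero = hor 0
edgeAt (suc e) = edgeSuc e

-- position of A_i (A_{n+1} is identified with A₀ by reduction mod N)
posA : (n i : ℕ) → ℕ
posA n zero = zero
posA n (suc i) = (suc (i + i)) % Npts n

-- position of the left endpoint of u_i (this is A_i)
leftEnd : (n i : ℕ) → ℕ
leftEnd n i = posA n i

-- position of the upper endpoint of v_j (this is A_{j+1})
upperEnd : (n j : ℕ) → ℕ
upperEnd n j = posA n (suc j)

-- number of edges of PQ: going northeast from P to Q, looping if needed;
-- the full loop if P = Q.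
pathLen : (n p q : ℕ) → ℕ
pathLen n p q = if p ≡ᵇ q then Npts n else (q + Npts n ∸ p) % Npts n

pathEdges : (n p q : ℕ) → List Edge
pathEdges n p q = map (λ k → edgeAt ((p + k) % Npts n)) (upTo (pathLen n p q))

interior : (n p q : ℕ) → List ℕ
interior n p q = map (λ k → (p + k) % Npts n) (drop 1 (upTo (pathLen n p q)))

-- Subsets S₁ ⊆ D₁ = {u₀,…,uₙ}  as  Subset (suc n)  (index i ↦ u_i)
-- Subsets S₂ ⊆ D₂ = {v₁,…,vₙ}  as  Subset n        (index j ↦ v_{j+1})

memb : ∀ {m} → Vec Bool m → ℕ → Bool
memb [] _ = false
memb (b ∷ _) zero = b
memb (_ ∷ bs) (suc k) = memb bs k

isH : Edge → Bool
isH (hor _) = true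
isH (ver _) = false

isV : Edge → Bool
isV (hor _) = false
isV (ver _) = true

inS₁ : ∀ {n} → Subset (suc n) → Edge → Bool
inS₁ S₁ (hor i) = memb S₁ i
inS₁ S₁ (ver _) = false

inS₂ : ∀ {n} → Subset n → Edge → Bool
inS₂ S₂ (hor _) = false
inS₂ S₂ (ver zero) = false
inS₂ S₂ (ver (suc j)) = memb S₂ j

count : (Edge → Bool) → List Edge → ℕ
count P [] = 0
count P (e ∷ es) = if P e then suc (count P es) else count P es

nH nV : (n p q : ℕ) → ℕ
nH n p q = count isH (pathEdges n p q)
nV n p q = count isV (pathEdges n p q)

nH∩S₁ : ∀ {n} → Subset (suc n) → (p q : ℕ) → ℕ
nH∩S₁ {n} S₁ p q = count (inS₁ S₁) (pathEdges n p q)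

nV∩S₂ : ∀ {n} → Subset n → (p q : ℕ) → ℕ
nV∩S₂ {n} S₂ p q = count (inS₂ S₂) (pathEdges n p q)

Compatible : (n : ℕ) → Subset (suc n) → Subset n → Set
Compatible n S₁ S₂ =
  ∀ (i : Fin (suc n)) (j : Fin n) → i ∈ₛ S₁ → j ∈ₛ S₂ →
  let E = leftEnd n (toℕ i)
      F = upperEnd n (suc (toℕ j))
  in ∃[ A ] (A ∈ interior n E F ×
       ((nH n A F ≡ 2 * nV∩S₂ S₂ A F) ⊎ (nV n E A ≡ 2 * nH∩S₁ S₁ E A)))
  where open import Relation.Binary.PropositionalEquality using (_≡_)

fC : (n : ℕ) → Subset (suc n) → Subset n → (c a b : ℕ) → ℤ
fC n S₁ S₂ c a b = + nV n a c - + (2 * nH∩S₁ S₁ a c)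

gC : (n : ℕ) → Subset (suc n) → Subset n → (c a b : ℕ) → ℤ
gC n S₁ S₂ c a b = + nH n c b - + (2 * nV∩S₂ S₂ c b)

-- maximum of a finite list of integers; the max over the empty set is
-- taken to be -∞, represented here by -1 (any negative value gives the
-- same truth value of "max ≥ 0").
maxℤ : List ℤ → ℤ
maxℤ [] = -[1+ 0 ]
maxℤ (x ∷ []) = x
maxℤ (x ∷ y ∷ ys) = x ⊔ maxℤ (y ∷ ys)

maxFG : (n : ℕ) → Subset (suc n) → Subset n → (a b : ℕ) → ℤ
maxFG n S₁ S₂ a b =
  maxℤ (map (λ c → fC n S₁ S₂ c a b ⊔ gC n S₁ S₂ c a b) (interior n a b))

-- Going along the subpath A_i A_{j+2} from its first to its last lattice
-- point, f rises by at most one per edge (it gains 1 on a vertical edge and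
-- loses 0 or 2 on a horizontal one), and f is negative right after the first
-- edge u_i ∈ S₁.  So if f(C) ≥ 0 somewhere, f hits 0 exactly at some earlier
-- interior point, and such a point witnesses compatibility.  Dually g,
-- read from the end of the path backwards, rises by at most one per edge and
-- is negative right before the last edge v_{j+1} ∈ S₂.  Conversely a point
-- witnessing compatibility makes f or g vanish there.
module Submission where

open import Defs
open import Data.Nat using (ℕ; suc)
open import Data.Fin using (Fin; toℕ)
open import Data.Fin.Properties using (toℕ<n)
open import Data.Fin.Subset using (Subset; _∈_)
open import Data.Integer using (_≥_; +_)
open import Function.Bundles using (_⇔_)

open import Data.Nat
  using (zero; _+_; _*_; _∸_; _≤_; _<_; _≤′_; ≤′-refl; ≤′-step; z≤n; s≤s; z<s; pred; _≡ᵇ_; _≤?_;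
         NonZero; >-nonZero)
open import Data.Nat.Properties
open import Data.Nat.DivMod
  using (_%_; _/_; m≡m%n+[m/n]*n; [m+kn]%n≡m%n; [m+n]%n≡m%n; %-distribˡ-+; m%n%n≡m%n; m<n⇒m%n≡m; m%n<n)
open import Data.Integer using (_-_; _⊔_; +≤+) renaming (_≤_ to _≤ℤ_)
import Data.Integer.Properties as ℤ
open import Data.Bool using (true; false; T)
open import Data.Unit using (tt)
open import Data.Vec using (_∷_; here; there)
open import Data.List using ([]; _∷_; map; upTo; applyUpTo; take; drop)
open import Data.List.Properties using (map-upTo; map-cong; map-∘; take-map; drop-map)
open import Data.List.Membership.Propositional using () renaming (_∈_ to _∈ₗ_)
open import Data.List.Membership.Propositional.Properties using (∈-map⁺; ∈-map⁻; ∈-applyUpTo⁺; ∈-applyUpTo⁻)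
open import Data.List.Relation.Unary.Any using (here; there)
open import Data.Product using (∃-syntax; _×_; _,_)
open import Data.Sum using (_⊎_; inj₁; inj₂)
open import Data.Empty using (⊥-elim)
open import Relation.Nullary using (yes; no)
open import Relation.Binary.PropositionalEquality
open import Function using (_∘_)
open import Function.Bundles using (mk⇔)

-- Discrete intermediate value theorems

upcrossing : (x y : ℕ → ℕ) → (∀ t → x (suc t) ≤ suc (x t)) → (∀ t → y t ≤ y (suc t)) →
  ∀ {m k} → m ≤ k → x m < y m → y k ≤ x k → ∃[ t ] (m < t × t ≤ k × x t ≡ y t)
upcrossing x y x-step y-mono m≤k = go (≤⇒≤′ m≤k)
  where
  go : ∀ {m k} → m ≤′ k → x m < y m → y k ≤ x k → ∃[ t ] (m < t × t ≤ k × x t ≡ y t)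
  go ≤′-refl xm<ym ym≤xm = ⊥-elim (<⇒≱ xm<ym ym≤xm)
  go {k = suc k} (≤′-step m≤′k) xm<ym yk+1≤xk+1 with y k ≤? x k
  ... | yes yk≤xk with go m≤′k xm<ym yk≤xk
  ...   | t , m<t , t≤k , xt≡yt = t , m<t , m≤n⇒m≤1+n t≤k , xt≡yt
  go {k = suc k} (≤′-step m≤′k) _ yk+1≤xk+1 | no yk≰xk =
    suc k , s≤s (≤′⇒≤ m≤′k) , ≤-refl ,
    ≤-antisym (≤-trans (x-step k) (≤-trans (≰⇒> yk≰xk) (y-mono k))) yk+1≤xk+1

downcrossing : (x y : ℕ → ℕ) → (∀ t → x t ≤ suc (x (suc t))) → (∀ t → y (suc t) ≤ y t) →
  ∀ {k m} → k ≤ m → y k ≤ x k → x m < y m → ∃[ t ] (k ≤ t × t < m × x t ≡ y t)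
downcrossing x y x-step y-anti k≤m = go (≤⇒≤′ k≤m)
  where
  go : ∀ {k m} → k ≤′ m → y k ≤ x k → x m < y m → ∃[ t ] (k ≤ t × t < m × x t ≡ y t)
  go ≤′-refl yk≤xk xk<yk = ⊥-elim (<⇒≱ xk<yk yk≤xk)
  go {m = suc m} (≤′-step k≤′m) yk≤xk xm+1<ym+1 with y m ≤? x m
  ... | yes ym≤xm =
    m , ≤′⇒≤ k≤′m , ≤-refl ,
    ≤-antisym (≤-trans (x-step m) (≤-trans xm+1<ym+1 (y-anti m))) ym≤xm
  ... | no ym≰xm with go k≤′m yk≤xk (≰⇒> ym≰xm)
  ...   | t , k≤t , t<m , xt≡yt = t , k≤t , m<n⇒m<1+n t<m , xt≡yt

count-take-suc : ∀ P t es → count P (take (suc t) es) ≤ suc (count P (take t es))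
count-take-suc P t [] = z≤n
count-take-suc P zero (e ∷ es) with P e
... | true = ≤-refl
... | false = z≤n
count-take-suc P (suc t) (e ∷ es) with P e
... | true = s≤s (count-take-suc P t es)
... | false = count-take-suc P t es

count-take-mono : ∀ P t es → count P (take t es) ≤ count P (take (suc t) es)
count-take-mono P zero es = z≤n
count-take-mono P (suc t) [] = z≤n
count-take-mono P (suc t) (e ∷ es) with P e
... | true = s≤s (count-take-mono P t es)
... | false = count-take-mono P t es

count-drop-pred : ∀ P t es → count P (drop t es) ≤ suc (count P (drop (suc t) es))
count-drop-pred P zero [] = z≤n
count-drop-pred P zero (e ∷ es) with P e
... | true = ≤-refl
... | false = n≤1+n (count P es)
count-drop-pred P (suc t) [] = z≤n
count-drop-pred P (suc t) (e ∷ es) = count-drop-pred P t es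

count-drop-anti : ∀ P t es → count P (drop (suc t) es) ≤ count P (drop t es)
count-drop-anti P zero [] = z≤n
count-drop-anti P zero (e ∷ es) with P e
... | true = n≤1+n (count P es)
... | false = ≤-refl
count-drop-anti P (suc t) [] = z≤n
count-drop-anti P (suc t) (e ∷ es) = count-drop-anti P t es

take-applyUpTo : ∀ {A : Set} (f : ℕ → A) {t L} → t ≤ L → take t (applyUpTo f L) ≡ applyUpTo f t
take-applyUpTo f z≤n = refl
take-applyUpTo f (s≤s t≤L) = cong (f 0 ∷_) (take-applyUpTo (f ∘ suc) t≤L)

drop-applyUpTo : ∀ {A : Set} (f : ℕ → A) t L → drop t (applyUpTo f L) ≡ applyUpTo (f ∘ (_+_ t)) (L ∸ t)
drop-applyUpTo f zero L = refl
drop-applyUpTo f (suc t) zero = refl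
drop-applyUpTo f (suc t) (suc L) = drop-applyUpTo (f ∘ suc) t L

drop-applyUpTo-last : ∀ {A : Set} (f : ℕ → A) l → drop l (applyUpTo f (suc l)) ≡ f l ∷ []
drop-applyUpTo-last f zero = refl
drop-applyUpTo-last f (suc l) = drop-applyUpTo-last (f ∘ suc) l

take-upTo : ∀ {t L} → t ≤ L → take t (upTo L) ≡ upTo t
take-upTo = take-applyUpTo (λ k → k)

drop-upTo : ∀ t L → drop t (upTo L) ≡ map (_+_ t) (upTo (L ∸ t))
drop-upTo t L = trans (drop-applyUpTo (λ k → k) t L) (sym (map-upTo (_+_ t) (L ∸ t)))

take-1-map-upTo : ∀ {A : Set} (g : ℕ → A) {L} → 0 < L → take 1 (map g (upTo L)) ≡ g 0 ∷ []
take-1-map-upTo g (s≤s z≤n) = refl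

drop-pred-map-upTo : ∀ {A : Set} (g : ℕ → A) {L} → 0 < L → drop (pred L) (map g (upTo L)) ≡ g (pred L) ∷ []
drop-pred-map-upTo g {suc l} _ = trans (cong (drop l) (map-upTo g (suc l))) (drop-applyUpTo-last g l)

[m%n+k]%n≡[m+k]%n : ∀ m k n .{{_ : NonZero n}} → (m % n + k) % n ≡ (m + k) % n
[m%n+k]%n≡[m+k]%n m k n = begin
  (m % n + k) % n         ≡⟨ %-distribˡ-+ (m % n) k n ⟩
  (m % n % n + k % n) % n ≡⟨ cong (λ r → (r + k % n) % n) (m%n%n≡m%n m n) ⟩
  (m % n + k % n) % n     ≡⟨ %-distribˡ-+ m k n ⟨
  (m + k) % n             ∎
  where open ≡-Reasoning

-- If p + x = r + aN and p + y = r + bN, then x + bN = y + aN.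
+-%-cancelˡ : ∀ {N} .{{_ : NonZero N}} p {x y} → x < N → y < N → (p + x) % N ≡ (p + y) % N → x ≡ y
+-%-cancelˡ {N} p {x} {y} x<N y<N eq = begin
  x               ≡⟨ m<n⇒m%n≡m x<N ⟨
  x % N           ≡⟨ [m+kn]%n≡m%n x b N ⟨
  (x + b * N) % N ≡⟨ cong (_% N) (+-cancelˡ-≡ p _ _ shifted) ⟩
  (y + a * N) % N ≡⟨ [m+kn]%n≡m%n y a N ⟩
  y % N           ≡⟨ m<n⇒m%n≡m y<N ⟩
  y               ∎
  where
  open ≡-Reasoning
  a = (p + x) / N
  b = (p + y) / N
  r = (p + x) % N
  shifted : p + (x + b * N) ≡ p + (y + a * N)
  shifted = begin
    p + (x + b * N)   ≡⟨ +-assoc p x (b * N) ⟨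
    p + x + b * N     ≡⟨ cong (_+ b * N) (m≡m%n+[m/n]*n (p + x) N) ⟩
    r + a * N + b * N ≡⟨ +-assoc r (a * N) (b * N) ⟩
    r + (a * N + b * N) ≡⟨ cong (_+_ r) (+-comm (a * N) (b * N)) ⟩
    r + (b * N + a * N) ≡⟨ +-assoc r (b * N) (a * N) ⟨
    r + b * N + a * N ≡⟨ cong (λ s → s + b * N + a * N) eq ⟩
    (p + y) % N + b * N + a * N ≡⟨ cong (_+ a * N) (m≡m%n+[m/n]*n (p + y) N) ⟨
    p + y + a * N     ≡⟨ +-assoc p y (a * N) ⟩
    p + (y + a * N)   ∎

edgeSuc-even : ∀ t → edgeSuc (t + t) ≡ hor (suc t)
edgeSuc-even zero = refl
edgeSuc-even (suc t) rewrite +-suc t t = cong shiftE (edgeSuc-even t)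

edgeSuc-odd : ∀ t → edgeSuc (suc (t + t)) ≡ ver (suc t)
edgeSuc-odd zero = refl
edgeSuc-odd (suc t) rewrite +-suc t t = cong shiftE (edgeSuc-odd t)

-- Subpaths of the cyclic path

module _ (n : ℕ) where
  private
    N : ℕ
    N = Npts n

  pointAt : ℕ → ℕ → ℕ
  pointAt p t = (p + t) % N

  posA<N : ∀ a → posA n a < N
  posA<N zero = z<s
  posA<N (suc a) = m%n<n (suc (a + a)) N

  pointAt-pointAt : ∀ p a b → pointAt (pointAt p a) b ≡ pointAt p (a + b)
  pointAt-pointAt p a b = trans ([m%n+k]%n≡[m+k]%n (p + a) b N) (cong (_% N) (+-assoc p a b))

  pathLen≤N : ∀ p q → pathLen n p q ≤ N
  pathLen≤N p q with p ≡ᵇ q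
  ... | true = ≤-refl
  ... | false = <⇒≤ (m%n<n (q + N ∸ p) N)

  pathLen<N : ∀ {p q} → p ≢ q → pathLen n p q < N
  pathLen<N {p} {q} p≢q with p ≡ᵇ q in p≡ᵇq
  ... | true = ⊥-elim (p≢q (≡ᵇ⇒≡ p q (subst T (sym p≡ᵇq) tt)))
  ... | false = m%n<n (q + N ∸ p) N

  pathLen-end : ∀ {p q} → p < N → q < N → pointAt p (pathLen n p q) ≡ q
  pathLen-end {p} {q} p<N q<N with p ≡ᵇ q in p≡ᵇq
  ... | true = trans ([m+n]%n≡m%n p N) (trans (m<n⇒m%n≡m p<N) (≡ᵇ⇒≡ p q (subst T (sym p≡ᵇq) tt)))
  ... | false = begin
    (p + (q + N ∸ p) % N) % N ≡⟨ cong (_% N) (+-comm p _) ⟩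
    ((q + N ∸ p) % N + p) % N ≡⟨ [m%n+k]%n≡[m+k]%n (q + N ∸ p) p N ⟩
    (q + N ∸ p + p) % N       ≡⟨ cong (_% N) (m∸n+n≡m (≤-trans (<⇒≤ p<N) (m≤n+m N q))) ⟩
    (q + N) % N               ≡⟨ [m+n]%n≡m%n q N ⟩
    q % N                     ≡⟨ m<n⇒m%n≡m q<N ⟩
    q                         ∎
    where open ≡-Reasoning

  pathLen-pointAt : ∀ {p d} → p < N → 0 < d → d < N → pathLen n p (pointAt p d) ≡ d
  pathLen-pointAt {p} {d} p<N 0<d d<N =
    +-%-cancelˡ p (pathLen<N p≢q) d<N (pathLen-end p<N (m%n<n (p + d) N))
    where
    p≢q : p ≢ pointAt p d
    p≢q p≡q = <⇒≢ 0<d (+-%-cancelˡ p z<s d<N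
      (trans (cong (_% N) (+-identityʳ p)) (trans (m<n⇒m%n≡m p<N) p≡q)))

  interior⁻ : ∀ p q {c} → c ∈ₗ interior n p q → ∃[ t ] (0 < t × t < pathLen n p q × c ≡ pointAt p t)
  interior⁻ p q c∈ with pathLen n p q | ∈-map⁻ (pointAt p) c∈
  ... | suc l | t , t∈ , c≡ with ∈-applyUpTo⁻ suc t∈
  ...   | s , s<l , refl = suc s , z<s , s≤s s<l , c≡

  interior⁺ : ∀ p q {t} → 0 < t → t < pathLen n p q → pointAt p t ∈ₗ interior n p q
  interior⁺ p q {suc s} _ s<L with pathLen n p q
  ... | suc l = ∈-map⁺ (pointAt p) (∈-applyUpTo⁺ suc (≤-pred s<L))

  module Split {E F : ℕ} (E<N : E < N) (F<N : F < N)
               {t : ℕ} (0<t : 0 < t) (t<L : t < pathLen n E F) where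
    private
      L : ℕ
      L = pathLen n E F

    pathEdges-take : pathEdges n E (pointAt E t) ≡ take t (pathEdges n E F)
    pathEdges-take = begin
      pathEdges n E (pointAt E t)
        ≡⟨ cong (λ l → map (edgeAt ∘ pointAt E) (upTo l)) (pathLen-pointAt E<N 0<t t<N) ⟩
      map (edgeAt ∘ pointAt E) (upTo t)
        ≡⟨ cong (map _) (take-upTo (<⇒≤ t<L)) ⟨
      map (edgeAt ∘ pointAt E) (take t (upTo L))
        ≡⟨ take-map t (upTo L) ⟨
      take t (pathEdges n E F) ∎
      where
      open ≡-Reasoning
      t<N = <-≤-trans t<L (pathLen≤N E F)

    pathEdges-drop : pathEdges n (pointAt E t) F ≡ drop t (pathEdges n E F)
    pathEdges-drop = begin
      pathEdges n C F
        ≡⟨ cong (λ l → map (edgeAt ∘ pointAt C) (upTo l)) lenCF ⟩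
      map (edgeAt ∘ pointAt C) (upTo (L ∸ t))
        ≡⟨ map-cong (cong edgeAt ∘ pointAt-pointAt E t) (upTo (L ∸ t)) ⟩
      map (edgeAt ∘ pointAt E ∘ (_+_ t)) (upTo (L ∸ t))
        ≡⟨ map-∘ (upTo (L ∸ t)) ⟩
      map (edgeAt ∘ pointAt E) (map (_+_ t) (upTo (L ∸ t)))
        ≡⟨ cong (map _) (drop-upTo t L) ⟨
      map (edgeAt ∘ pointAt E) (drop t (upTo L))
        ≡⟨ drop-map t (upTo L) ⟨
      drop t (pathEdges n E F) ∎
      where
      open ≡-Reasoning
      C = pointAt E t
      F≡ : F ≡ pointAt C (L ∸ t)
      F≡ = trans (sym (pathLen-end E<N F<N))
        (trans (cong (pointAt E) (sym (m+[n∸m]≡n (<⇒≤ t<L)))) (sym (pointAt-pointAt E t (L ∸ t))))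
      lenCF : pathLen n C F ≡ L ∸ t
      lenCF = trans (cong (pathLen n C) F≡)
        (pathLen-pointAt (m%n<n (E + t) N) (m<n⇒0<n∸m t<L)
          (<-≤-trans (∸-monoʳ-< 0<t (<⇒≤ t<L)) (pathLen≤N E F)))

  edgeAt-posA : ∀ {i} → i ≤ n → edgeAt (posA n i) ≡ hor i
  edgeAt-posA {zero} _ = refl
  edgeAt-posA {suc i} i<n
    rewrite m<n⇒m%n≡m {n = N} (s≤s (+-mono-≤ i<n (<⇒≤ i<n))) = edgeSuc-even i

  edgeAt-before-posA : ∀ {j y} → j < n → y < N → pointAt y 1 ≡ posA n (suc (suc j)) →
    edgeAt y ≡ ver (suc j)
  edgeAt-before-posA {j} {y} j<n y<N ends = subst (λ z → edgeAt z ≡ ver (suc j)) (sym y≡) fin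
    where
    y≡ : y ≡ suc j + suc j
    y≡ = +-%-cancelˡ 1 y<N (s≤s (+-mono-≤ j<n j<n)) (trans (cong (_% N) (+-comm 1 y)) ends)
    fin : edgeAt (suc j + suc j) ≡ ver (suc j)
    fin rewrite +-suc j j = edgeSuc-odd j

  pathEdges-first : ∀ {i F} → i ≤ n → 0 < pathLen n (posA n i) F →
    take 1 (pathEdges n (posA n i) F) ≡ hor i ∷ []
  pathEdges-first {i} {F} i≤n 0<L = begin
    take 1 (pathEdges n E F)      ≡⟨ take-1-map-upTo (edgeAt ∘ pointAt E) 0<L ⟩
    edgeAt ((E + 0) % N) ∷ []     ≡⟨ cong (λ e → edgeAt (e % N) ∷ []) (+-identityʳ E) ⟩
    edgeAt (E % N) ∷ []           ≡⟨ cong (λ e → edgeAt e ∷ []) (m<n⇒m%n≡m (posA<N i)) ⟩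
    edgeAt E ∷ []                 ≡⟨ cong (_∷ []) (edgeAt-posA i≤n) ⟩
    hor i ∷ []                    ∎
    where
    open ≡-Reasoning
    E = posA n i

  pathEdges-last : ∀ {E j} → E < N → j < n → 0 < pathLen n E (posA n (suc (suc j))) →
    drop (pred (pathLen n E (posA n (suc (suc j))))) (pathEdges n E (posA n (suc (suc j))))
      ≡ ver (suc j) ∷ []
  pathEdges-last {E} {j} E<N j<n 0<L =
    trans (drop-pred-map-upTo (edgeAt ∘ pointAt E) 0<L)
      (cong (_∷ []) (edgeAt-before-posA j<n (m%n<n (E + pred L) N) ends))
    where
    F = posA n (suc (suc j))
    L = pathLen n E F
    ends : pointAt (pointAt E (pred L)) 1 ≡ F
    ends = begin
      pointAt (pointAt E (pred L)) 1 ≡⟨ pointAt-pointAt E (pred L) 1 ⟩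
      pointAt E (pred L + 1)         ≡⟨ cong (pointAt E) (+-comm (pred L) 1) ⟩
      pointAt E (suc (pred L))       ≡⟨ cong (pointAt E) (suc-pred L {{>-nonZero 0<L}}) ⟩
      pointAt E L                    ≡⟨ pathLen-end E<N (posA<N (suc (suc j))) ⟩
      F                              ∎
      where open ≡-Reasoning

≤⊔⁻ : ∀ {z} a b → z ≤ℤ a ⊔ b → z ≤ℤ a ⊎ z ≤ℤ b
≤⊔⁻ {z} a b z≤a⊔b with ℤ.⊔-sel a b
... | inj₁ a⊔b≡a = inj₁ (subst (z ≤ℤ_) a⊔b≡a z≤a⊔b)
... | inj₂ a⊔b≡b = inj₂ (subst (z ≤ℤ_) a⊔b≡b z≤a⊔b)

≤maxℤ : ∀ {z x xs} → x ∈ₗ xs → z ≤ℤ x → z ≤ℤ maxℤ xs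
≤maxℤ {xs = _ ∷ []} (here refl) z≤x = z≤x
≤maxℤ {xs = _ ∷ _ ∷ _} (here refl) z≤x = ℤ.≤-trans z≤x (ℤ.i≤i⊔j _ _)
≤maxℤ {xs = _ ∷ _ ∷ _} (there x∈) z≤x = ℤ.≤-trans (≤maxℤ x∈ z≤x) (ℤ.i≤j⊔i _ _)

0≤maxℤ⁻ : ∀ xs → + 0 ≤ℤ maxℤ xs → ∃[ x ] (x ∈ₗ xs × + 0 ≤ℤ x)
0≤maxℤ⁻ [] ()
0≤maxℤ⁻ (x ∷ []) 0≤x = x , here refl , 0≤x
0≤maxℤ⁻ (x ∷ y ∷ ys) 0≤max = pick (≤⊔⁻ x (maxℤ (y ∷ ys)) 0≤max) (0≤maxℤ⁻ (y ∷ ys))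
  where
  pick : + 0 ≤ℤ x ⊎ + 0 ≤ℤ maxℤ (y ∷ ys) →
    (+ 0 ≤ℤ maxℤ (y ∷ ys) → ∃[ z ] (z ∈ₗ y ∷ ys × + 0 ≤ℤ z)) → ∃[ z ] (z ∈ₗ x ∷ y ∷ ys × + 0 ≤ℤ z)
  pick (inj₁ 0≤x) _ = x , here refl , 0≤x
  pick (inj₂ 0≤max′) rest with rest 0≤max′
  ... | z , z∈ , 0≤z = z , there z∈ , 0≤z

0≤+m-+n⇒n≤m : ∀ {m n} → + 0 ≤ℤ + m - + n → n ≤ m
0≤+m-+n⇒n≤m 0≤m-n = ℤ.drop‿+≤+ (ℤ.0≤i-j⇒j≤i 0≤m-n)

m≡n⇒0≤+m-+n : ∀ {m n} → m ≡ n → + 0 ≤ℤ + m - + n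
m≡n⇒0≤+m-+n m≡n = ℤ.i≤j⇒0≤j-i (+≤+ (≤-reflexive (sym m≡n)))

memb-∈ : ∀ {m} (S : Subset m) {i : Fin m} → i ∈ S → memb S (toℕ i) ≡ true
memb-∈ (_ ∷ _) here = refl
memb-∈ (_ ∷ S) (there i∈S) = memb-∈ S i∈S

-- Compatibility and the signs of f and g

module _ (n : ℕ) (S₁ : Subset (suc n)) (S₂ : Subset n) where
  private
    N : ℕ
    N = Npts n

  CompatibleAt : ℕ → ℕ → Set
  CompatibleAt E F = ∃[ a ] (a ∈ₗ interior n E F ×
    ((nH n a F ≡ 2 * nV∩S₂ S₂ a F) ⊎ (nV n E a ≡ 2 * nH∩S₁ S₁ E a)))

  f-crossing : ∀ {i F c} → i ≤ n → memb S₁ i ≡ true → F < N →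
    c ∈ₗ interior n (posA n i) F → 2 * nH∩S₁ S₁ (posA n i) c ≤ nV n (posA n i) c →
    ∃[ a ] (a ∈ₗ interior n (posA n i) F × nV n (posA n i) a ≡ 2 * nH∩S₁ S₁ (posA n i) a)
  f-crossing {i} {F} i≤n u∈S₁ F<N c∈ = crossing (interior⁻ n E F c∈)
    where
    E = posA n i
    L = pathLen n E F
    es = pathEdges n E F
    x y : ℕ → ℕ
    x s = count isV (take s es)
    y s = 2 * count (inS₁ S₁) (take s es)
    prefix : ∀ {s} → 0 < s → s < L → pathEdges n E (pointAt n E s) ≡ take s es
    prefix = Split.pathEdges-take n (posA<N n i) F<N
    start : 0 < L → x 1 < y 1
    start 0<L rewrite pathEdges-first n {F = F} i≤n 0<L | u∈S₁ = z<s
    crossing : ∀ {c} → ∃[ t ] (0 < t × t < L × c ≡ pointAt n E t) → 2 * nH∩S₁ S₁ E c ≤ nV n E c →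
      ∃[ a ] (a ∈ₗ interior n E F × nV n E a ≡ 2 * nH∩S₁ S₁ E a)
    crossing (t , 0<t , t<L , refl) f≥0
      with upcrossing x y (λ s → count-take-suc isV s es)
             (λ s → *-monoʳ-≤ 2 (count-take-mono (inS₁ S₁) s es))
             0<t (start (<-trans 0<t t<L))
             (subst (λ es′ → 2 * count (inS₁ S₁) es′ ≤ count isV es′) (prefix 0<t t<L) f≥0)
    ... | s , 1<s , s≤t , xs≡ys =
      pointAt n E s , interior⁺ n E F 0<s s<L ,
      subst (λ es′ → count isV es′ ≡ 2 * count (inS₁ S₁) es′) (sym (prefix 0<s s<L)) xs≡ys
      where
      0<s = <-trans z<s 1<s
      s<L = ≤-<-trans s≤t t<L

  g-crossing : ∀ {j E c} → j < n → memb S₂ j ≡ true → E < N →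
    c ∈ₗ interior n E (posA n (suc (suc j))) →
    2 * nV∩S₂ S₂ c (posA n (suc (suc j))) ≤ nH n c (posA n (suc (suc j))) →
    ∃[ a ] (a ∈ₗ interior n E (posA n (suc (suc j))) ×
            nH n a (posA n (suc (suc j))) ≡ 2 * nV∩S₂ S₂ a (posA n (suc (suc j))))
  g-crossing {j} {E} j<n v∈S₂ E<N c∈ = crossing (interior⁻ n E F c∈)
    where
    F = posA n (suc (suc j))
    L = pathLen n E F
    es = pathEdges n E F
    x y : ℕ → ℕ
    x s = count isH (drop s es)
    y s = 2 * count (inS₂ S₂) (drop s es)
    suffix : ∀ {s} → 0 < s → s < L → pathEdges n (pointAt n E s) F ≡ drop s es
    suffix = Split.pathEdges-drop n E<N (posA<N n (suc (suc j)))
    end : 0 < L → x (pred L) < y (pred L)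
    end 0<L rewrite pathEdges-last n E<N j<n 0<L | v∈S₂ = z<s
    crossing : ∀ {c} → ∃[ t ] (0 < t × t < L × c ≡ pointAt n E t) → 2 * nV∩S₂ S₂ c F ≤ nH n c F →
      ∃[ a ] (a ∈ₗ interior n E F × nH n a F ≡ 2 * nV∩S₂ S₂ a F)
    crossing (t , 0<t , t<L , refl) g≥0
      with downcrossing x y (λ s → count-drop-pred isH s es)
             (λ s → *-monoʳ-≤ 2 (count-drop-anti (inS₂ S₂) s es))
             (<⇒≤pred t<L) (subst (λ es′ → 2 * count (inS₂ S₂) es′ ≤ count isH es′) (suffix 0<t t<L) g≥0)
             (end (<-trans 0<t t<L))
    ... | s , t≤s , s<L-1 , xs≡ys =
      pointAt n E s , interior⁺ n E F 0<s s<L ,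
      subst (λ es′ → count isH es′ ≡ 2 * count (inS₂ S₂) es′) (sym (suffix 0<s s<L)) xs≡ys
      where
      0<s = ≤-trans 0<t t≤s
      s<L = <-≤-trans s<L-1 pred[n]≤n

  CompatibleAt⇒0≤maxFG : ∀ E F → CompatibleAt E F → + 0 ≤ℤ maxFG n S₁ S₂ E F
  CompatibleAt⇒0≤maxFG E F (a , a∈ , vanishes) = ≤maxℤ (∈-map⁺ _ a∈) (f⊔g≥0 vanishes)
    where
    f⊔g≥0 : (nH n a F ≡ 2 * nV∩S₂ S₂ a F) ⊎ (nV n E a ≡ 2 * nH∩S₁ S₁ E a) →
      + 0 ≤ℤ fC n S₁ S₂ a E F ⊔ gC n S₁ S₂ a E F
    f⊔g≥0 (inj₁ g≡0) = ℤ.≤-trans (m≡n⇒0≤+m-+n g≡0) (ℤ.i≤j⊔i _ _)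
    f⊔g≥0 (inj₂ f≡0) = ℤ.≤-trans (m≡n⇒0≤+m-+n f≡0) (ℤ.i≤i⊔j _ _)

  0≤maxFG⁻ : ∀ E F → + 0 ≤ℤ maxFG n S₁ S₂ E F →
    ∃[ c ] (c ∈ₗ interior n E F × (+ 0 ≤ℤ fC n S₁ S₂ c E F ⊎ + 0 ≤ℤ gC n S₁ S₂ c E F))
  0≤maxFG⁻ E F 0≤max with 0≤maxℤ⁻ _ 0≤max
  ... | _ , x∈ , 0≤x with ∈-map⁻ (λ c → fC n S₁ S₂ c E F ⊔ gC n S₁ S₂ c E F) x∈
  ... | c , c∈ , refl = c , c∈ , ≤⊔⁻ (fC n S₁ S₂ c E F) (gC n S₁ S₂ c E F) 0≤x

  0≤maxFG⇒CompatibleAt : ∀ (i : Fin (suc n)) (j : Fin n) → i ∈ S₁ → j ∈ S₂ →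
    + 0 ≤ℤ maxFG n S₁ S₂ (posA n (toℕ i)) (posA n (suc (suc (toℕ j)))) →
    CompatibleAt (posA n (toℕ i)) (posA n (suc (suc (toℕ j))))
  0≤maxFG⇒CompatibleAt i j i∈S₁ j∈S₂ 0≤max
    with 0≤maxFG⁻ (posA n (toℕ i)) (posA n (suc (suc (toℕ j)))) 0≤max
  ... | c , c∈ , inj₁ f≥0
    with f-crossing {toℕ i} (≤-pred (toℕ<n i)) (memb-∈ S₁ i∈S₁) (posA<N n (suc (suc (toℕ j))))
           c∈ (0≤+m-+n⇒n≤m f≥0)
  ...   | a , a∈ , f≡0 = a , a∈ , inj₂ f≡0
  0≤maxFG⇒CompatibleAt i j i∈S₁ j∈S₂ 0≤max | c , c∈ , inj₂ g≥0
    with g-crossing {toℕ j} {posA n (toℕ i)} (toℕ<n j) (memb-∈ S₂ j∈S₂) (posA<N n (toℕ i))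
           c∈ (0≤+m-+n⇒n≤m g≥0)
  ...   | a , a∈ , g≡0 = a , a∈ , inj₁ g≡0

mainTheorem8 : (n : ℕ) (S₁ : Subset (suc n)) (S₂ : Subset n) →
    Compatible n S₁ S₂ ⇔
      (∀ (i : Fin (suc n)) (j : Fin n) → i ∈ S₁ → j ∈ S₂ →
        maxFG n S₁ S₂ (posA n (toℕ i)) (posA n (suc (suc (toℕ j)))) ≥ + 0)
mainTheorem8 n S₁ S₂ = mk⇔
  (λ compatible i j i∈S₁ j∈S₂ →
     CompatibleAt⇒0≤maxFG n S₁ S₂ (posA n (toℕ i)) _ (compatible i j i∈S₁ j∈S₂))
  (λ 0≤maxFG i j i∈S₁ j∈S₂ →
     0≤maxFG⇒CompatibleAt n S₁ S₂ i j i∈S₁ j∈S₂ (0≤maxFG i j i∈S₁ j∈S₂))
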